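{- Let $k$ be a positive integer and let $G$ be a graph that does not contain $K_k$ as a topological minor. Let $(T,\beta)$ be a tree decomposition of $G$ as provided by the Grohe–Marx decomposition theorem, with adhesion at most $a(k)$. Consider any run of the Construction on $G$, let $1\le i<\ell$, and let $C$ be a component of $G_i$ that is connected to the subgraphs $H_{i_1},\ldots,H_{i_s}$. If $s>a(k)$, then for every vertex $v\in V(C)\setminus\beta(t)$, where $t$ is the core node of the minor model $H_{i_1},\ldots,H_{i_s}$, we have $m_i(v)\le a(k)$.
   Context: A tree decomposition of $G$ is a pair $(T,\beta)$ with $T$ a tree and $\beta:V(T)\to 2^{V(G)}$ such that for every $v\in V(G)$ the set $\{t:v\in\beta(t)\}$ is non-empty and connected in $T$, and every edge of $G$ is contained in some $\beta(t)$. Its adhesion is $\max\{|\beta(s)\cap\beta(t)|:st\in E(T)\}$. The torso at $t$ is $G[\beta(t)]$ together with all edges making each $\beta(s)\cap\beta(t)$, $st\in E(T)$, a clique. Grohe–Marx decomposition theorem: for every $k$ there are constants $a(k),c(k),d(k),e(k)$ such that every graph excluding $K_k$ as a topological minor has a tree decomposition of adhesion at most $a(k)$ in which every node's torso either has at most $c(k)$ vertices of degree larger than $d(k)$, or excludes $K_{e(k)}$ as a minor. $K_k$ is a topological minor of $G$ if there are $k$ distinct vertices and pairwise internally vertex-disjoint paths connecting every pair of them. When $s>a(k)$, the core node of the minor model $H_{i_1},\ldots,H_{i_s}$ is the node $t\in V(T)$ whose bag $\beta(t)$ intersects at least $a(k)+1$ of the branch sets $V(H_{i_j})$ (such a node exists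 and is unique). Construction. One iteratively builds pairwise vertex-disjoint connected subgraphs $H_1,\ldots,H_\ell$ covering $V(G)$. Let $G_i:=G-\bigcup_{j\le i}V(H_j)$. A component $C$ of $G_i$ is connected to $H_j$ ($j\le i$) if some edge of $G$ joins $V(H_j)$ and $V(C)$. Start with $H_1:=G[\{v\}]$ for an arbitrary $v$. Given $H_1,\ldots,H_i$ not covering $V(G)$, fix a component $C$ of $G_i$, let $H_{i_1},\ldots,H_{i_s}$ be the subgraphs connected to $C$ (they are pairwise joined by edges of $G$). For $v\in V(C)$, $m_i(v)$ is the maximum cardinality of a family of paths, each connecting $v$ with a different one of $H_{i_1},\ldots,H_{i_s}$, whose internal vertices belong to $G_i$, and which are pairwise disjoint apart from $v$. Choose $v\in V(C)$ maximising $m_i(v)$, take a BFS tree of $C$ rooted at $v$, and let $H_{i+1}$ be a minimal connected subtree of it containing $v$ and, for each $j$, a vertex of $C$ adjacent to $H_{i_j}$. Open choices are arbitrary. -}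

module Defs where

open import Data.Nat using (ℕ; zero; suc; _≤_; _<_)
open import Data.Fin using (Fin)
import Data.Fin as F
open import Data.Fin.Subset using (Subset; _∈_; _∉_; _⊆_; _∩_; _∪_; ⁅_⁆; ∣_∣) renaming (⊥ to ∅)
open import Data.Bool using (Bool; T; false)
open import Data.List using (List; []; _∷_; _++_; [_])
open import Data.List.Membership.Propositional using () renaming (_∈_ to _∈ₗ_)
open import Data.List.Relation.Unary.Linked using (Linked)
open import Data.List.Relation.Unary.Unique.Propositional using (Unique)
open import Data.Product using (Σ; ∃; ∃₂; _×_; _,_; ∃-syntax)
open import Data.Sum using (_⊎_)
open import Data.Empty using (⊥)
open import Data.Unit using (⊤)
open import Relation.Nullary using (¬_)
open import Relation.Binary.PropositionalEquality using (_≡_; _≢_)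
open import Relation.Binary.Construct.Closure.ReflexiveTransitive using (Star)

record Graph : Set where
  field
    n          : ℕ
    adj        : Fin n → Fin n → Bool
    adj-sym    : ∀ x y → adj x y ≡ adj y x
    adj-irrefl : ∀ x → adj x x ≡ false

open Graph public

V : Graph → Set
V G = Fin (n G)

Edge : (G : Graph) → V G → V G → Set
Edge G x y = T (adj G x y)

verts : {A : Set} → A → List A → A → List A
verts x is y = x ∷ is ++ [ y ]

record Path {A : Set} (E : A → A → Set) (x y : A) : Set where
  field
    inner  : List A
    linked : Linked E (verts x inner y)
    unique : Unique (verts x inner y)

open Path public

pathVerts : {A : Set} {E : A → A → Set} {x y : A} → Path E x y → List A
pathVerts {x = x} {y = y} p = verts x (inner p) y

ConnectedIn : {A : Set} → (A → A → Set) → (A → Set) → Set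
ConnectedIn E P = ∀ x y → P x → P y → Star (λ a b → E a b × P a × P b) x y

Acyclic : Graph → Set
Acyclic G = ∀ x y (p : Path (Edge G) x y) → inner p ≢ [] → ¬ Edge G y x

record IsTree (G : Graph) : Set where
  field
    nonempty  : 1 ≤ n G
    connected : ConnectedIn (Edge G) (λ _ → ⊤)
    acyclic   : Acyclic G

record TreeDec (G : Graph) : Set where
  field
    Tr    : Graph
    isTree : IsTree Tr
    β     : V Tr → Subset (n G)
    occurs    : ∀ v → ∃[ t ] v ∈ β t
    occ-conn  : ∀ v → ConnectedIn (Edge Tr) (λ t → v ∈ β t)
    edge-cov  : ∀ u v → Edge G u v → ∃[ t ] (u ∈ β t × v ∈ β t)

open TreeDec public

AdhesionAtMost : {G : Graph} → TreeDec G → ℕ → Set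
AdhesionAtMost D a = ∀ s t → Edge (Tr D) s t → ∣ β D s ∩ β D t ∣ ≤ a

TorsoEdge : {G : Graph} (D : TreeDec G) → V (Tr D) → V G → V G → Set
TorsoEdge {G} D t u v =
  u ∈ β D t × v ∈ β D t × u ≢ v ×
  (Edge G u v ⊎ ∃[ s ] (Edge (Tr D) s t × u ∈ β D s × v ∈ β D s))

FewHighDegree : {m : ℕ} → (Fin m → Set) → (Fin m → Fin m → Set) → ℕ → ℕ → Set
FewHighDegree {m} P E c d =
  ∃[ X ] (∣ X ∣ ≤ c ×
    (∀ v → P v → v ∉ X →
      ∃[ N ] (∣ N ∣ ≤ d × (∀ u → P u → E v u → u ∈ N))))

record CliqueMinor {m : ℕ} (P : Fin m → Set) (E : Fin m → Fin m → Set) (e : ℕ) : Set where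
  field
    B         : Fin e → Subset m
    nonempty  : ∀ i → ∃[ x ] x ∈ B i
    inside    : ∀ i x → x ∈ B i → P x
    connected : ∀ i → ConnectedIn E (λ x → x ∈ B i)
    disjoint  : ∀ i j → i ≢ j → ∀ x → x ∈ B i → x ∉ B j
    touching  : ∀ i j → i ≢ j → ∃₂ λ x y → x ∈ B i × y ∈ B j × E x y

GMTorsos : {G : Graph} → TreeDec G → ℕ → ℕ → ℕ → Set
GMTorsos D c d e = ∀ t →
  FewHighDegree (λ x → x ∈ β D t) (TorsoEdge D t) c d
  ⊎ ¬ CliqueMinor (λ x → x ∈ β D t) (TorsoEdge D t) e

record TopMinor (G : Graph) (k : ℕ) : Set where
  field
    b     : Fin k → V G
    b-inj : ∀ i j → b i ≡ b j → i ≡ j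
    P     : (i j : Fin k) → i F.< j → Path (Edge G) (b i) (b j)
    int-disj : ∀ i j i' j' (p : i F.< j) (p' : i' F.< j') → (i ≢ i' ⊎ j ≢ j') →
               ∀ x → x ∈ₗ inner (P i j p) → x ∈ₗ pathVerts (P i' j' p') → ⊥

-- The Construction.  Subgraphs H_1, H_2, ... are given by their vertex
-- sets  H : ℕ → Subset n  (index 0 unused).

module Construction (G : Graph) (H : ℕ → Subset (n G)) where

  Used : ℕ → Subset (n G)
  Used zero    = ∅
  Used (suc i) = Used i ∪ H (suc i)

  InGi : ℕ → V G → Set
  InGi i x = x ∉ Used i

  record IsComponent (i : ℕ) (C : Subset (n G)) : Set where
    field
      nonempty  : ∃[ x ] x ∈ C
      inside    : ∀ x → x ∈ C → InGi i x
      connected : ConnectedIn (Edge G) (λ x → x ∈ C)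
      maximal   : ∀ D → C ⊆ D → (∀ x → x ∈ D → InGi i x) →
                  ConnectedIn (Edge G) (λ x → x ∈ D) → D ⊆ C

  ConnTo : ℕ → Subset (n G) → Set
  ConnTo j C = ∃₂ λ x y → x ∈ H j × y ∈ C × Edge G x y

  Attached : ℕ → Subset (n G) → ℕ → Set
  Attached i C j = 1 ≤ j × j ≤ i × ConnTo j C

  -- a family of m paths witnessing m_i(v) ≥ m
  record Fan (i : ℕ) (C : Subset (n G)) (v : V G) (m : ℕ) : Set where
    field
      tgt      : Fin m → ℕ
      tgt-inj  : ∀ p q → tgt p ≡ tgt q → p ≡ q
      tgt-ok   : ∀ p → Attached i C (tgt p)
      end      : Fin m → V G
      end-in   : ∀ p → end p ∈ H (tgt p)
      path     : (p : Fin m) → Path (Edge G) v (end p)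
      inner-in : ∀ p x → x ∈ₗ inner (path p) → InGi i x
      disjoint : ∀ p q → p ≢ q → ∀ x → x ∈ₗ pathVerts (path p) →
                 x ∈ₗ pathVerts (path q) → x ≡ v

  MaxFan : ℕ → Subset (n G) → V G → Set
  MaxFan i C v = ∀ w → w ∈ C → ∀ m → Fan i C w m → ∃[ m' ] (m ≤ m' × Fan i C v m')

  -- a BFS tree of C rooted at v: rk is the order in which BFS dequeues
  -- vertices, par the BFS parent (the earliest dequeued neighbour).
  record BFSTree (C : Subset (n G)) (v : V G) : Set where
    field
      rk        : V G → ℕ
      par       : V G → V G
      rk-inj    : ∀ x y → x ∈ C → y ∈ C → rk x ≡ rk y → x ≡ y
      root-first : ∀ x → x ∈ C → x ≢ v → rk v < rk x
      par-in    : ∀ x → x ∈ C → x ≢ v → par x ∈ C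
      par-edge  : ∀ x → x ∈ C → x ≢ v → Edge G x (par x)
      par-before : ∀ x → x ∈ C → x ≢ v → rk (par x) < rk x
      par-first : ∀ x → x ∈ C → x ≢ v → ∀ w → w ∈ C → Edge G x w → rk (par x) ≤ rk w
      fifo      : ∀ x y → x ∈ C → y ∈ C → x ≢ v → y ≢ v →
                  rk (par x) < rk (par y) → rk x < rk y

    TreeEdge : V G → V G → Set
    TreeEdge x y = (x ∈ C × x ≢ v × y ≡ par x) ⊎ (y ∈ C × y ≢ v × x ≡ par y)

  record Step (i : ℕ) : Set where
    field
      C      : Subset (n G)
      comp   : IsComponent i C
      root   : V G
      root-in : root ∈ C
      root-max : MaxFan i C root
      bfs    : BFSTree C root
      tg     : ℕ → V G
      tg-ok  : ∀ j → Attached i C j → tg j ∈ C × ∃[ y ] (y ∈ H j × Edge G (tg j) y)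
      sub-C     : H (suc i) ⊆ C
      sub-root  : root ∈ H (suc i)
      sub-tg    : ∀ j → Attached i C j → tg j ∈ H (suc i)
      sub-conn  : ConnectedIn (BFSTree.TreeEdge bfs) (λ x → x ∈ H (suc i))
      sub-min   : ∀ S → S ⊆ H (suc i) → root ∈ S → (∀ j → Attached i C j → tg j ∈ S) →
                  ConnectedIn (BFSTree.TreeEdge bfs) (λ x → x ∈ S) → H (suc i) ⊆ S

record Run (G : Graph) : Set where
  field
    ℓ     : ℕ
    H     : ℕ → Subset (n G)
    first : ∃[ v ] H 1 ≡ ⁅ v ⁆
    steps : ∀ i → 1 ≤ i → i < ℓ → Construction.Step G H i
    ℓ≥1   : 1 ≤ ℓ
    cover : ∀ x → x ∈ Construction.Used G H ℓ

open Run public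

AtLeast : ℕ → (ℕ → Set) → Set
AtLeast q Q = Σ (Fin q → ℕ) λ js → ((∀ p p' → js p ≡ js p' → p ≡ p') × (∀ (p : Fin q) → Q (js p)))

-- Let s be the neighbour of the core node t on the tree path from a bag containing v, and
-- Adh = β(s) ∩ β(t), so |Adh| ≤ a(k).  Adh separates the vertices occurring in bags on s's side
-- of T − t from β(t).  The paths of a fan at v, each extended by its target subgraph, are pairwise
-- disjoint away from v ∉ Adh, as are the attached subgraphs meeting β(t); so if both families have
-- more than |Adh| members, by pigeonhole one fan path together with its target, and one attached
-- subgraph meeting β(t), avoid Adh.  Attached subgraphs are connected and pairwise adjacent, so
-- starting from v we walk into β(t) without touching Adh, which is impossible.
module Submission where

open import Defs
open import Data.Nat using (ℕ; zero; suc; _≤_; _<_; _≤?_; s≤s; z≤n)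
import Data.Nat as ℕ
open import Data.Nat.Properties
  using (≤-trans; <-≤-trans; ≤-<-trans; <⇒≤; ≤-pred; n≤1+n; n<1+n; m≤n⇒m<n∨m≡n; <-cmp; ≰⇒>; <⇒≱)
open import Data.Fin using (Fin; zero; suc)
open import Data.Fin.Properties using (suc-injective; injective⇒≤; any?) renaming (_≟_ to _≟ᶠ_)
open import Data.Fin.Subset using (Subset; _∈_; _∉_; _∩_; _∪_; _⊆_; ∣_∣; inside; outside)
open import Data.Fin.Subset.Properties
  using (_∈?_; x∈p∩q⁺; x∈p∩q⁻; x∈p∪q⁻; p⊆p∪q; q⊆p∪q; x∈⁅y⁆⇒x≡y)
open import Data.Vec.Base using (_∷_; here; there)
open import Data.Bool using (T)
open import Data.Maybe using (just)
open import Data.Maybe.Properties using (just-injective)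
open import Data.Maybe.Relation.Binary.Connected using (Connected; just)
open import Data.List using (List; []; _∷_; _++_; last)
open import Data.List.Relation.Unary.Any using (here; there)
open import Data.List.Relation.Unary.All as All using (All; []; _∷_)
open import Data.List.Relation.Unary.All.Properties using (¬Any⇒All¬)
open import Data.List.Relation.Unary.AllPairs as AllPairs using ([]; _∷_)
open import Data.List.Relation.Unary.Linked as Linked using (Linked; []; [-]; _∷_)
import Data.List.Relation.Unary.Linked.Properties as Linked
open import Data.List.Relation.Unary.Unique.Propositional using (Unique)
import Data.List.Relation.Unary.Unique.Propositional.Properties as Unique
open import Data.List.Membership.Propositional using () renaming (_∈_ to _∈ₗ_)
open import Data.List.Membership.Propositional.Properties using (∈-∃++; ∈-++⁺ʳ; ∈-++⁻)
import Data.List.Membership.DecPropositional as DecMembership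
open import Data.Product using (Σ; ∃₂; ∃-syntax; _×_; _,_; proj₁; proj₂)
open import Data.Sum using (_⊎_; inj₁; inj₂)
open import Data.Empty using (⊥; ⊥-elim)
open import Data.Unit using (tt)
open import Function using (id; _∘_)
open import Relation.Nullary using (¬_; Dec; yes; no)
open import Relation.Nullary.Decidable using (_×-dec_; _⊎-dec_; ¬?)
open import Relation.Binary using (DecidableEquality; tri<; tri≈; tri>)
open import Relation.Binary.PropositionalEquality using (_≡_; _≢_; refl; sym; cong; subst; ≢-sym)
open import Relation.Binary.Construct.Closure.ReflexiveTransitive using (Star; ε; _◅_; _◅◅_)
  renaming (map to Star-map)

Edge-sym : (Γ : Graph) {x y : V Γ} → Edge Γ x y → Edge Γ y x
Edge-sym Γ {x} {y} = subst T (adj-sym Γ x y)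

Edge⇒≢ : (Γ : Graph) {x y : V Γ} → Edge Γ x y → x ≢ y
Edge⇒≢ Γ {x} e refl = subst T (adj-irrefl Γ x) e

end∈pathVerts : {A : Set} {E : A → A → Set} {x y : A} (p : Path E x y) → y ∈ₗ pathVerts p
end∈pathVerts p = there (∈-++⁺ʳ (inner p) (here refl))

_within_ : {A : Set} → (A → A → Set) → (A → Set) → A → A → Set
(E within P) a b = E a b × P a × P b

within-mono : {A : Set} {E : A → A → Set} {P Q : A → Set} → (∀ {a} → P a → Q a) →
              ∀ {x y} → Star (E within P) x y → Star (E within Q) x y
within-mono P⊆Q = Star-map (λ (e , Pa , Pb) → e , P⊆Q Pa , P⊆Q Pb)

∪-connected : ∀ {m} {E : Fin m → Fin m → Set} {P Q : Subset m} {p q} → (∀ {a b} → E a b → E b a) →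
              ConnectedIn E (_∈ P) → ConnectedIn E (_∈ Q) → p ∈ P → q ∈ Q → E p q →
              ConnectedIn E (_∈ P ∪ Q)
∪-connected {E = E} {P} {Q} {p} {q} E-sym P-conn Q-conn p∈P q∈Q p-q x y x∈ y∈ =
  join (x∈p∪q⁻ P Q x∈) (x∈p∪q⁻ P Q y∈)
  where
    inP = within-mono (p⊆p∪q Q)
    inQ = within-mono (q⊆p∪q P Q)

    join : x ∈ P ⊎ x ∈ Q → y ∈ P ⊎ y ∈ Q → Star (E within (_∈ P ∪ Q)) x y
    join (inj₁ x∈P) (inj₁ y∈P) = inP (P-conn x y x∈P y∈P)
    join (inj₂ x∈Q) (inj₂ y∈Q) = inQ (Q-conn x y x∈Q y∈Q)
    join (inj₁ x∈P) (inj₂ y∈Q) =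
      inP (P-conn x p x∈P p∈P) ◅◅ (p-q , p⊆p∪q Q p∈P , q⊆p∪q P Q q∈Q) ◅ inQ (Q-conn q y q∈Q y∈Q)
    join (inj₂ x∈Q) (inj₁ y∈P) =
      inQ (Q-conn x q x∈Q q∈Q) ◅◅ (E-sym p-q , q⊆p∪q P Q q∈Q , p⊆p∪q Q p∈P) ◅ inP (P-conn p y p∈P y∈P)

rank : ∀ {m} (X : Subset m) {x} → x ∈ X → Fin ∣ X ∣
rank (inside  ∷ X) here        = zero
rank (inside  ∷ X) (there x∈X) = suc (rank X x∈X)
rank (outside ∷ X) (there x∈X) = rank X x∈X

rank-injective : ∀ {m} (X : Subset m) {x y} (x∈X : x ∈ X) (y∈X : y ∈ X) →
                 rank X x∈X ≡ rank X y∈X → x ≡ y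
rank-injective (inside  ∷ X) here        here        _  = refl
rank-injective (inside  ∷ X) here        (there _)   ()
rank-injective (inside  ∷ X) (there _)   here        ()
rank-injective (inside  ∷ X) (there x∈X) (there y∈X) eq =
  cong suc (rank-injective X x∈X y∈X (suc-injective eq))
rank-injective (outside ∷ X) (there x∈X) (there y∈X) eq = cong suc (rank-injective X x∈X y∈X eq)

injection-into-subset⇒≤ : ∀ {k m} (X : Subset m) (f : Fin k → Fin m) (f∈X : ∀ p → f p ∈ X) →
                          (∀ {p q} → f p ≡ f q → p ≡ q) → k ≤ ∣ X ∣
injection-into-subset⇒≤ X f f∈X f-inj =
  injective⇒≤ (λ {p} {q} eq → f-inj (rank-injective X (f∈X p) (f∈X q) eq))

disjoint-family-misses : ∀ {k m} (X : Subset m) (P : Fin k → Fin m → Set) → (∀ p x → Dec (P p x)) →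
                         (∀ {p q x} → p ≢ q → x ∈ X → P p x → P q x → ⊥) → ∣ X ∣ < k →
                         ∃[ p ] ∀ x → P p x → x ∉ X
disjoint-family-misses X P P? disjoint ∣X∣<k
  with any? (λ p → ¬? (any? (λ x → (x ∈? X) ×-dec P? p x)))
... | yes (p , misses) = p , λ x Ppx x∈X → misses (x , x∈X , Ppx)
... | no ¬misses = ⊥-elim (<⇒≱ ∣X∣<k (injection-into-subset⇒≤ X (proj₁ ∘ hit) (proj₁ ∘ proj₂ ∘ hit) injective))
  where
    hit : ∀ p → ∃[ x ] (x ∈ X × P p x)
    hit p with any? (λ x → (x ∈? X) ×-dec P? p x)
    ... | yes h = h
    ... | no ¬h = ⊥-elim (¬misses (p , ¬h))

    injective : ∀ {p q} → proj₁ (hit p) ≡ proj₁ (hit q) → p ≡ q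
    injective {p} {q} eq with p ≟ᶠ q
    ... | yes p≡q = p≡q
    ... | no p≢q = ⊥-elim (disjoint p≢q (proj₁ (proj₂ (hit p))) (proj₂ (proj₂ (hit p)))
                                        (subst (P q) (sym eq) (proj₂ (proj₂ (hit q)))))

module SimpleWalks {A : Set} (_≟_ : DecidableEquality A) where
  open DecMembership _≟_ using () renaming (_∈?_ to _∈ₗ?_)

  record SimpleWalk (R : A → A → Set) (P : A → Set) (x y : A) : Set where
    constructor simpleWalk
    field
      rest     : List A
      ends     : last (x ∷ rest) ≡ just y
      isLinked : Linked R (x ∷ rest)
      isUnique : Unique (x ∷ rest)
      through  : All P (x ∷ rest)

  suffix : (Q : List A → Set) → (∀ {a b l} → Q (a ∷ b ∷ l) → Q (b ∷ l)) →
           ∀ {z x} ys zs → Q (z ∷ ys ++ x ∷ zs) → Q (x ∷ zs)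
  suffix Q drop-head []       zs q = drop-head q
  suffix Q drop-head (_ ∷ ys) zs q = suffix Q drop-head ys zs (drop-head q)

  restart-at : ∀ {R P z x y} (w : SimpleWalk R P z y) → x ∈ₗ SimpleWalk.rest w → SimpleWalk R P x y
  restart-at {R} {P} {y = y} (simpleWalk l ends lk un al) x∈l with ∈-∃++ x∈l
  ... | ys , zs , refl =
    simpleWalk zs (suffix (λ l → last l ≡ just y) id ys zs ends) (suffix (Linked R) Linked.tail ys zs lk)
                  (suffix Unique AllPairs.tail ys zs un) (suffix (All P) All.tail ys zs al)

  shorten : ∀ {R P x y} → (∀ {a b} → R a b → P a) → P y → Star R x y → SimpleWalk R P x y
  shorten R⇒P Py ε = simpleWalk [] refl [-] ([] ∷ []) (Py ∷ [])
  shorten {x = x} R⇒P Py (_◅_ {j = z} r walk) with shorten R⇒P Py walk | x ≟ z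
  ... | w | yes refl = w
  ... | w@(simpleWalk l ends lk un al) | no x≢z with x ∈ₗ? l
  ...   | yes x∈l = restart-at w x∈l
  ...   | no x∉l  = simpleWalk (z ∷ l) ends (r ∷ lk) (fresh ∷ un) (R⇒P r ∷ al)
    where
      fresh : All (x ≢_) (z ∷ l)
      fresh = ¬Any⇒All¬ (z ∷ l) λ { (here x≡z) → x≢z x≡z ; (there x∈l) → x∉l x∈l }

module _ (Γ : Graph) where
  open SimpleWalks (_≟ᶠ_ {n Γ})

  Avoiding : V Γ → V Γ → V Γ → Set
  Avoiding t a b = Edge Γ a b × a ≢ t × b ≢ t

  -- Otherwise the t-avoiding walk from u to s, shortened to a path and closed up by s–t–u, is a cycle.
  acyclic⇒entry-unique : Acyclic Γ → ∀ {s t u} → Edge Γ s t → Edge Γ u t → Star (Avoiding t) u s → u ≡ s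
  acyclic⇒entry-unique acyclic {s} {t} {u} s-t u-t walk with u ≟ᶠ s
  ... | yes u≡s = u≡s
  ... | no u≢s with shorten (proj₁ ∘ proj₂) (Edge⇒≢ Γ s-t) walk
  ... | simpleWalk rest ends lk un al = ⊥-elim (acyclic u t cycle (nonempty ends) (Edge-sym Γ u-t))
    where
      cycle : Path (Edge Γ) u t
      cycle = record
        { inner  = rest
        ; linked = Linked.++⁺ (Linked.map proj₁ lk)
                              (subst (λ m → Connected (Edge Γ) m (just t)) (sym ends) (just s-t)) [-]
        ; unique = Unique.++⁺ un ([] ∷ []) λ { (w∈ , here refl) → All.lookup al w∈ refl }
        }
      nonempty : ∀ {l} → last (u ∷ l) ≡ just s → l ≢ []
      nonempty ends refl = u≢s (just-injective ends)

  walk⇒entry : ∀ {u t} → u ≢ t → Star (Edge Γ) u t → ∃[ s ] (Edge Γ s t × Star (Avoiding t) u s)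
  walk⇒entry u≢t ε = ⊥-elim (u≢t refl)
  walk⇒entry {u} {t} u≢t (_◅_ {j = w} u-w walk) with w ≟ᶠ t
  ... | yes refl = u , u-w , ε
  ... | no w≢t with walk⇒entry w≢t walk
  ...   | s , s-t , side = s , s-t , (u-w , u≢t , w≢t) ◅ side

module Separation {G : Graph} (D : TreeDec G) {s t : V (Tr D)} (s-t : Edge (Tr D) s t) where

  Side : V (Tr D) → Set
  Side u = Star (Avoiding (Tr D) t) u s

  Adh : Subset (n G)
  Adh = β D s ∩ β D t

  OnSide : V G → Set
  OnSide x = ∃[ u ] (Side u × x ∈ β D u)

  side≢t : ∀ {u} → Side u → u ≢ t
  side≢t ε                   = Edge⇒≢ (Tr D) s-t
  side≢t ((_ , u≢t , _) ◅ _) = u≢t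

  side-step : ∀ {u w} → Side u → Edge (Tr D) u w → w ≢ t → Side w
  side-step side u-w w≢t = (Edge-sym (Tr D) u-w , w≢t , side≢t side) ◅ side

  leave-side : ∀ {x a b} → Side a → Star (Edge (Tr D) within (λ u → x ∈ β D u)) a b → Side b ⊎ x ∈ Adh
  leave-side side ε = inj₁ side
  leave-side {x} side (_◅_ {j = u} (a-u , x∈a , x∈u) walk) with u ≟ᶠ t
  ... | yes refl = inj₂ (x∈p∩q⁺ (subst (λ w → x ∈ β D w) a≡s x∈a , x∈u))
    where a≡s = acyclic⇒entry-unique (Tr D) (IsTree.acyclic (isTree D)) s-t a-u side
  ... | no u≢t = leave-side (side-step side a-u u≢t) walk

  onSide⇒side⊎Adh : ∀ {x b} → OnSide x → x ∈ β D b → Side b ⊎ x ∈ Adh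
  onSide⇒side⊎Adh {x} (a , side , x∈a) x∈b = leave-side side (occ-conn D x a _ x∈a x∈b)

  onSide-edge : ∀ {x y} → OnSide x → x ∉ Adh → Edge G x y → OnSide y
  onSide-edge x-side x∉Adh x-y with edge-cov D _ _ x-y
  ... | b , x∈b , y∈b with onSide⇒side⊎Adh x-side x∈b
  ...   | inj₁ side  = b , side , y∈b
  ...   | inj₂ x∈Adh = ⊥-elim (x∉Adh x∈Adh)

  onSide∩β-t⊆Adh : ∀ {x} → OnSide x → x ∈ β D t → x ∈ Adh
  onSide∩β-t⊆Adh x-side x∈t with onSide⇒side⊎Adh x-side x∈t
  ... | inj₁ side  = ⊥-elim (side≢t side refl)
  ... | inj₂ x∈Adh = x∈Adh

  onSide-walk : ∀ {P : V G → Set} {x y} → (∀ z → P z → z ∉ Adh) →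
                OnSide x → Star (Edge G within P) x y → OnSide y
  onSide-walk clear x-side ε = x-side
  onSide-walk clear x-side ((x-z , Px , _) ◅ walk) =
    onSide-walk clear (onSide-edge x-side (clear _ Px) x-z) walk

  onSide-linked : ∀ {x l} → (∀ z → z ∈ₗ x ∷ l → z ∉ Adh) →
                  OnSide x → Linked (Edge G) (x ∷ l) → All OnSide (x ∷ l)
  onSide-linked clear x-side [-] = x-side ∷ []
  onSide-linked clear x-side (x-y ∷ lk) =
    x-side ∷ onSide-linked (λ z z∈ → clear z (there z∈)) (onSide-edge x-side (clear _ (here refl)) x-y) lk

  onSide-path : ∀ {x y} (p : Path (Edge G) x y) → (∀ z → z ∈ₗ pathVerts p → z ∉ Adh) → OnSide x → OnSide y
  onSide-path p clear x-side = All.lookup (onSide-linked clear x-side (linked p)) (end∈pathVerts p)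

vertex-on-some-side : ∀ {G} (D : TreeDec G) {t v} → v ∉ β D t →
                      ∃[ s ] Σ (Edge (Tr D) s t) λ s-t → Separation.OnSide D s-t v
vertex-on-some-side D {t} {v} v∉t with occurs D v
... | u , v∈u with walk⇒entry (Tr D) (λ u≡t → v∉t (subst (λ w → v ∈ β D w) u≡t v∈u))
                    (Star-map proj₁ (IsTree.connected (isTree D) u t tt tt))
...   | s , s-t , u-side = s , s-t , u , u-side , v∈u

module RunFacts {G : Graph} (r : Run G) where
  open Construction G (H r)

  Used-mono : ∀ {k i x} → k ≤ i → x ∈ Used k → x ∈ Used i
  Used-mono {i = zero} z≤n x∈ = x∈
  Used-mono {i = suc i} k≤1+i x∈ with m≤n⇒m<n∨m≡n k≤1+i
  ... | inj₁ k<1+i = p⊆p∪q (H r (suc i)) (Used-mono (≤-pred k<1+i) x∈)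
  ... | inj₂ refl  = x∈

  H⊆Used : ∀ {j i x} → 1 ≤ j → j ≤ i → x ∈ H r j → x ∈ Used i
  H⊆Used {suc j} _ j≤i x∈ = Used-mono j≤i (q⊆p∪q (Used j) (H r (suc j)) x∈)

  H-disjoint-< : ∀ {j j' x} → 1 ≤ j → j < j' → j' < ℓ r → x ∈ H r j → x ∉ H r j'
  H-disjoint-< {j' = suc k} 1≤j (s≤s j≤k) j'<ℓ x∈j x∈j' =
    IsComponent.inside (Step.comp st) _ (Step.sub-C st x∈j') (H⊆Used 1≤j j≤k x∈j)
    where st = steps r _ (≤-trans 1≤j j≤k) (<-≤-trans (n<1+n k) (<⇒≤ j'<ℓ))

  H-disjoint : ∀ {j j' x} → 1 ≤ j → 1 ≤ j' → j < ℓ r → j' < ℓ r → j ≢ j' → x ∈ H r j → x ∉ H r j'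
  H-disjoint 1≤j 1≤j' j<ℓ j'<ℓ j≢j' x∈j x∈j' with <-cmp _ _
  ... | tri< j<j' _ _ = H-disjoint-< 1≤j j<j' j'<ℓ x∈j x∈j'
  ... | tri≈ _ j≡j' _ = j≢j' j≡j'
  ... | tri> _ _ j>j' = H-disjoint-< 1≤j' j>j' j<ℓ x∈j' x∈j

  treeEdge⇒Edge : ∀ {k x y} (st : Step k) → BFSTree.TreeEdge (Step.bfs st) x y → Edge G x y
  treeEdge⇒Edge st (inj₁ (x∈C , x≢root , refl)) = BFSTree.par-edge (Step.bfs st) _ x∈C x≢root
  treeEdge⇒Edge st (inj₂ (y∈C , y≢root , refl)) = Edge-sym G (BFSTree.par-edge (Step.bfs st) _ y∈C y≢root)

  H-connected : ∀ {j} → 1 ≤ j → j < ℓ r → ConnectedIn (Edge G) (_∈ H r j)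
  H-connected {suc zero} _ _ x y x∈ y∈ with first r
  ... | v , H₁≡⁅v⁆ with x∈⁅y⁆⇒x≡y v (subst (x ∈_) H₁≡⁅v⁆ x∈) | x∈⁅y⁆⇒x≡y v (subst (y ∈_) H₁≡⁅v⁆ y∈)
  ...   | refl | refl = ε
  H-connected {suc (suc k)} _ j<ℓ x y x∈ y∈ =
    Star-map (λ (e , a , b) → treeEdge⇒Edge st e , a , b) (Step.sub-conn st x y x∈ y∈)
    where st = steps r _ (s≤s z≤n) (<-≤-trans (n<1+n (suc k)) (<⇒≤ j<ℓ))

  -- By maximality of C_k: C ∪ C_k is a connected vertex set of G_k containing C_k.
  component-⊆-step : ∀ {i k C} → k ≤ i → IsComponent i C → (st : Step k) → ConnTo (suc k) C → C ⊆ Step.C st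
  component-⊆-step {k = k} {C} k≤i C-comp st (x , y , x∈H , y∈C , x-y) z∈C =
    IsComponent.maximal Cₖ-comp (C ∪ Cₖ) (q⊆p∪q C Cₖ) in-Gₖ
      (∪-connected (Edge-sym G) (IsComponent.connected C-comp) (IsComponent.connected Cₖ-comp)
                   y∈C (Step.sub-C st x∈H) (Edge-sym G x-y))
      (p⊆p∪q Cₖ z∈C)
    where
      Cₖ = Step.C st
      Cₖ-comp = Step.comp st
      in-Gₖ : ∀ w → w ∈ C ∪ Cₖ → InGi k w
      in-Gₖ w w∈ with x∈p∪q⁻ C Cₖ w∈
      ... | inj₁ w∈C  = IsComponent.inside C-comp w w∈C ∘ Used-mono k≤i
      ... | inj₂ w∈Cₖ = IsComponent.inside Cₖ-comp w w∈Cₖ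

  -- At step j' − 1 the subgraph H_j was attached to C_{j'−1} ⊇ C, so H_{j'} contains a neighbour of H_j.
  attached⇒index : ∀ {i C j} → i < ℓ r → Attached i C j → 1 ≤ j × j < ℓ r
  attached⇒index i<ℓ (1≤j , j≤i , _) = 1≤j , ≤-<-trans j≤i i<ℓ

  attached-disjoint : ∀ {i C j j' x} → i < ℓ r → Attached i C j → Attached i C j' → j ≢ j' →
                      x ∈ H r j → x ∉ H r j'
  attached-disjoint i<ℓ att att' =
    H-disjoint (proj₁ (attached⇒index i<ℓ att)) (proj₁ (attached⇒index i<ℓ att'))
               (proj₂ (attached⇒index i<ℓ att)) (proj₂ (attached⇒index i<ℓ att'))

  attached⊆Used : ∀ {i C j x} → Attached i C j → x ∈ H r j → x ∈ Used i
  attached⊆Used (1≤j , j≤i , _) = H⊆Used 1≤j j≤i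

  attached-adjacent-< : ∀ {i C j j'} → i < ℓ r → IsComponent i C → Attached i C j → Attached i C j' → j < j' →
                        ∃₂ λ y y' → y ∈ H r j × y' ∈ H r j' × Edge G y y'
  attached-adjacent-< {j' = suc k} i<ℓ C-comp (1≤j , _ , x , y , x∈H , y∈C , x-y) (_ , k<i , C-H) (s≤s j≤k) =
    proj₁ neighbour , Step.tg st _ , proj₁ (proj₂ neighbour) , Step.sub-tg st _ attached-at-k ,
    Edge-sym G (proj₂ (proj₂ neighbour))
    where
      k≤i = ≤-trans (n≤1+n k) k<i
      st = steps r _ (≤-trans 1≤j j≤k) (≤-<-trans k≤i i<ℓ)
      attached-at-k : Attached k (Step.C st) _
      attached-at-k = 1≤j , j≤k , x , y , x∈H , component-⊆-step k≤i C-comp st C-H y∈C , x-y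
      neighbour = proj₂ (Step.tg-ok st _ attached-at-k)

  attached-adjacent : ∀ {i C j j'} → i < ℓ r → IsComponent i C → Attached i C j → Attached i C j' → j ≢ j' →
                      ∃₂ λ y y' → y ∈ H r j × y' ∈ H r j' × Edge G y y'
  attached-adjacent i<ℓ C-comp att att' j≢j' with <-cmp _ _
  ... | tri< j<j' _ _ = attached-adjacent-< i<ℓ C-comp att att' j<j'
  ... | tri≈ _ j≡j' _ = ⊥-elim (j≢j' j≡j')
  ... | tri> _ _ j>j' with attached-adjacent-< i<ℓ C-comp att' att j>j'
  ...   | y , y' , y∈ , y'∈ , y-y' = y' , y , y'∈ , y∈ , Edge-sym G y-y'

module FanSeparation {G : Graph} (D : TreeDec G) (r : Run G) {s t : V (Tr D)} (s-t : Edge (Tr D) s t) where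
  open Separation D s-t
  open RunFacts r
  open Construction G (H r)
  open DecMembership (_≟ᶠ_ {n G}) using () renaming (_∈?_ to _∈ₗ?_)

  module _ {i} (i<ℓ : i < ℓ r) {C : Subset (n G)} (C-comp : IsComponent i C) where

    AttachedMeeting : V (Tr D) → ℕ → Set
    AttachedMeeting u j = Attached i C j × ∃[ x ] (x ∈ H r j × x ∈ β D u)

    FanPiece : ∀ {v m} → Fan i C v m → Fin m → V G → Set
    FanPiece F p x = x ∈ₗ pathVerts (Fan.path F p) ⊎ x ∈ H r (Fan.tgt F p)

    module _ {v m} (v∈C : v ∈ C) (F : Fan i C v m) where
      open Fan F

      path-vertex : ∀ p {x} → x ∈ₗ pathVerts (path p) → InGi i x ⊎ x ∈ H r (tgt p)
      path-vertex p (here refl) = inj₁ (IsComponent.inside C-comp v v∈C)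
      path-vertex p (there x∈) with ∈-++⁻ (inner (path p)) x∈
      ... | inj₁ x∈inner    = inj₁ (inner-in p _ x∈inner)
      ... | inj₂ (here refl) = inj₂ (end-in p)

      targets-disjoint : ∀ {p q x} → p ≢ q → x ∈ H r (tgt p) → x ∉ H r (tgt q)
      targets-disjoint {p} {q} p≢q = attached-disjoint i<ℓ (tgt-ok p) (tgt-ok q) (p≢q ∘ tgt-inj p q)

      path-avoids-other-target : ∀ {p q x} → p ≢ q → x ∈ₗ pathVerts (path p) → x ∉ H r (tgt q)
      path-avoids-other-target {p} {q} p≢q x∈p x∈q with path-vertex p x∈p
      ... | inj₁ x∈Gᵢ = x∈Gᵢ (attached⊆Used (tgt-ok q) x∈q)
      ... | inj₂ x∈tgt = targets-disjoint p≢q x∈tgt x∈q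

      pieces-meet-at-root : ∀ {p q x} → p ≢ q → FanPiece F p x → FanPiece F q x → x ≡ v
      pieces-meet-at-root {p} {q} p≢q (inj₁ x∈p) (inj₁ x∈q) = disjoint p q p≢q _ x∈p x∈q
      pieces-meet-at-root p≢q (inj₁ x∈p) (inj₂ x∈q) = ⊥-elim (path-avoids-other-target p≢q x∈p x∈q)
      pieces-meet-at-root p≢q (inj₂ x∈p) (inj₁ x∈q) = ⊥-elim (path-avoids-other-target (≢-sym p≢q) x∈q x∈p)
      pieces-meet-at-root p≢q (inj₂ x∈p) (inj₂ x∈q) = ⊥-elim (targets-disjoint p≢q x∈p x∈q)

      fan-piece-misses-Adh : v ∉ Adh → ∣ Adh ∣ < m → ∃[ p ] ∀ x → FanPiece F p x → x ∉ Adh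
      fan-piece-misses-Adh v∉Adh =
        disjoint-family-misses Adh (FanPiece F)
          (λ p x → (x ∈ₗ? pathVerts (path p)) ⊎-dec (x ∈? H r (tgt p)))
          (λ p≢q x∈Adh x∈p x∈q → v∉Adh (subst (_∈ Adh) (pieces-meet-at-root p≢q x∈p x∈q) x∈Adh))

    attached-misses-Adh : ∀ {K} → AtLeast K (AttachedMeeting t) → ∣ Adh ∣ < K →
                          ∃[ j ] (AttachedMeeting t j × ∀ x → x ∈ H r j → x ∉ Adh)
    attached-misses-Adh (js , js-inj , meets) ∣Adh∣<K
      with disjoint-family-misses Adh (λ q x → x ∈ H r (js q)) (λ q x → x ∈? H r (js q))
             (λ p≢q _ → attached-disjoint i<ℓ (proj₁ (meets _)) (proj₁ (meets _)) (p≢q ∘ js-inj _ _)) ∣Adh∣<K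
    ... | q , misses = js q , meets q , misses

    attached-onSide : ∀ {j x} → Attached i C j → (∀ z → z ∈ H r j → z ∉ Adh) →
                      ∃[ y ] (y ∈ H r j × OnSide y) → x ∈ H r j → OnSide x
    attached-onSide att clear (_ , y∈ , y-side) x∈ with attached⇒index i<ℓ att
    ... | 1≤j , j<ℓ = onSide-walk clear y-side (H-connected 1≤j j<ℓ _ _ y∈ x∈)

    no-clear-crossing : ∀ {v m j} → v ∈ C → OnSide v → (F : Fan i C v m) (p : Fin m) →
                        (∀ x → FanPiece F p x → x ∉ Adh) →
                        AttachedMeeting t j → (∀ x → x ∈ H r j → x ∉ Adh) → ⊥
    no-clear-crossing {j = j} v∈C v-side F p piece-clear (j-att , x , x∈j , x∈t) j-clear =
      j-clear x x∈j (onSide∩β-t⊆Adh (attached-onSide j-att j-clear enter-j x∈j) x∈t)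
      where
        open Fan F

        end-side : OnSide (end p)
        end-side = onSide-path (path p) (λ z z∈ → piece-clear z (inj₁ z∈)) v-side

        enter-j : ∃[ y ] (y ∈ H r j × OnSide y)
        enter-j with tgt p ℕ.≟ j
        ... | yes refl = end p , end-in p , end-side
        ... | no tgt≢j with attached-adjacent i<ℓ C-comp (tgt-ok p) j-att tgt≢j
        ...   | y , y' , y∈ , y'∈ , y-y' =
          y' , y'∈ , onSide-edge (attached-onSide (tgt-ok p) tgt-clear (end p , end-in p , end-side) y∈)
                                 (tgt-clear y y∈) y-y'
          where tgt-clear = λ z z∈ → piece-clear z (inj₂ z∈)

    fan≤∣Adh∣ : ∀ {K v m} → AtLeast K (AttachedMeeting t) → ∣ Adh ∣ < K →
                v ∈ C → v ∉ Adh → OnSide v → Fan i C v m → m ≤ ∣ Adh ∣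
    fan≤∣Adh∣ {m = m} meeting ∣Adh∣<K v∈C v∉Adh v-side F with m ≤? ∣ Adh ∣
    ... | yes m≤∣Adh∣ = m≤∣Adh∣
    ... | no m≰∣Adh∣ with fan-piece-misses-Adh v∈C F v∉Adh (≰⇒> m≰∣Adh∣) | attached-misses-Adh meeting ∣Adh∣<K
    ...   | p , piece-clear | j , j-meets , j-clear =
      ⊥-elim (no-clear-crossing v∈C v-side F p piece-clear j-meets j-clear)

lemma17 : (k a c d e : ℕ) (G : Graph) → 1 ≤ k → ¬ TopMinor G k →
          (D : TreeDec G) → AdhesionAtMost D a → GMTorsos D c d e →
          (r : Run G) → (i : ℕ) → 1 ≤ i → i < ℓ r →
          (C : Subset (n G)) → Construction.IsComponent G (H r) i C →
          AtLeast (suc a) (Construction.Attached G (H r) i C) →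
          (t : V (Tr D)) →
          AtLeast (suc a) (λ j → Construction.Attached G (H r) i C j × ∃[ x ] (x ∈ H r j × x ∈ β D t)) →
          (v : V G) → v ∈ C → v ∉ β D t →
          (m : ℕ) → Construction.Fan G (H r) i C v m → m ≤ a
lemma17 _ a _ _ _ G _ _ D adhesion≤a _ r _ _ i<ℓ C C-comp _ t meeting v v∈C v∉t m F
  with vertex-on-some-side D v∉t
... | s , s-t , v-side =
  ≤-trans (fan≤∣Adh∣ i<ℓ C-comp meeting (s≤s ∣Adh∣≤a) v∈C (v∉t ∘ proj₂ ∘ x∈p∩q⁻ _ _) v-side F) ∣Adh∣≤a
  where
    open Separation D s-t using (Adh)
    open FanSeparation D r s-t using (fan≤∣Adh∣)
    ∣Adh∣≤a : ∣ Adh ∣ ≤ a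
    ∣Adh∣≤a = adhesion≤a s t s-t
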